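{- Let $n \geq 1$ and let $N$ be a $\lambda$-term such that for distinct variables $a_1, \ldots, a_n$ not free in $N$ we have $N a_1 a_2 \cdots a_n =_\beta a_1 a_2 \cdots a_n (N a_1 a_2 \cdots a_n)$. Then $N\,I\,I\cdots I$ (with $n-1$ copies of $I = \lambda x.x$) is a fixed point combinator.
   Context: Untyped $\lambda$-calculus with $\beta$-conversion $=_\beta$; application associates to the left. A term $Y$ is a fixed point combinator if $Yx =_\beta x(Yx)$ for a variable $x$ not free in $Y$. -}

module Defs where

open import Data.Nat using (ℕ; zero; suc)
open import Data.List using (List; []; _∷_; foldl)
open import Data.Vec using (Vec)
open import Data.Product using (Σ; _×_)
open import Relation.Nullary using (¬_)

-- Untyped λ-terms with de Bruijn indices; a free variable is a natural
-- number (the index as seen at top level).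
infixl 7 _·_
data Term : Set where
  var : ℕ → Term
  _·_ : Term → Term → Term
  ƛ_  : Term → Term

ext : (ℕ → ℕ) → ℕ → ℕ
ext ρ zero    = zero
ext ρ (suc n) = suc (ρ n)

rename : (ℕ → ℕ) → Term → Term
rename ρ (var x) = var (ρ x)
rename ρ (M · N) = rename ρ M · rename ρ N
rename ρ (ƛ M)   = ƛ rename (ext ρ) M

exts : (ℕ → Term) → ℕ → Term
exts σ zero    = var zero
exts σ (suc n) = rename suc (σ n)

sub : (ℕ → Term) → Term → Term
sub σ (var x) = σ x
sub σ (M · N) = sub σ M · sub σ N
sub σ (ƛ M)   = ƛ sub (exts σ) M

σ₀ : Term → ℕ → Term
σ₀ M zero    = M
σ₀ M (suc n) = var n

_[_] : Term → Term → Term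
N [ M ] = sub (σ₀ M) N

infix 4 _⟶β_
data _⟶β_ : Term → Term → Set where
  β    : ∀ {M N} → (ƛ M) · N ⟶β M [ N ]
  appL : ∀ {M M′ N} → M ⟶β M′ → M · N ⟶β M′ · N
  appR : ∀ {M N N′} → N ⟶β N′ → M · N ⟶β M · N′
  lam  : ∀ {M M′} → M ⟶β M′ → ƛ M ⟶β ƛ M′

infix 4 _=β_
data _=β_ : Term → Term → Set where
  step  : ∀ {M N} → M ⟶β N → M =β N
  refl  : ∀ {M} → M =β M
  sym   : ∀ {M N} → M =β N → N =β M
  trans : ∀ {M N P} → M =β N → N =β P → M =β P

infix 4 _FreeIn_
data _FreeIn_ : ℕ → Term → Set where
  fvar : ∀ {x} → x FreeIn var x
  fappL : ∀ {x M N} → x FreeIn M → x FreeIn M · N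
  fappR : ∀ {x M N} → x FreeIn N → x FreeIn M · N
  flam  : ∀ {x M} → suc x FreeIn M → x FreeIn ƛ M

apps : Term → List Term → Term
apps = foldl _·_

I : Term
I = ƛ var zero

FixedPointCombinator : Term → Set
FixedPointCombinator Y =
  Σ ℕ (λ x → ¬ (x FreeIn Y) × (Y · var x =β var x · (Y · var x)))

module Submission where

-- Write a = a₀ a₁ … a_k and x = a_k (the last variable).  The
-- simultaneous substitution "spine a" sends a₀, …, a_{k-1} to I and fixes
-- every other variable, in particular x.  Since β-conversion is stable under
-- substitution, applying it to the hypothesis
--     N a₀ ⋯ a_k  =β  a₀ a₁ ⋯ a_k (N a₀ ⋯ a_k)
-- gives (using that no aᵢ is free in N)
--     N I ⋯ I x  =β  (I I ⋯ I x) (N I ⋯ I x)  =β  x (N I ⋯ I x),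
-- because a spine of identities I I ⋯ I x collapses to x.  Moreover x is not
-- free in Y = N I ⋯ I, since it is not free in N and I is closed.

open import Defs
open import Data.Nat using (ℕ; zero; suc; _≟_)
open import Data.Fin using (fromℕ)
import Data.Fin as Fin
open import Data.Fin.Properties using (suc-injective)
open import Data.Vec using (Vec; []; _∷_; lookup; toList; map; head; tail; last; replicate)
import Data.List as List
open import Data.Product using (_,_)
open import Data.Empty using (⊥-elim)
open import Relation.Nullary using (¬_; yes; no)
open import Relation.Binary.PropositionalEquality as Eq using (_≡_; cong; cong₂)
open Eq.≡-Reasoning

ext-cong : ∀ {ρ ρ′} → (∀ x → ρ x ≡ ρ′ x) → ∀ x → ext ρ x ≡ ext ρ′ x
ext-cong e zero    = Eq.refl
ext-cong e (suc x) = cong suc (e x)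

rename-cong : ∀ {ρ ρ′} → (∀ x → ρ x ≡ ρ′ x) → ∀ M → rename ρ M ≡ rename ρ′ M
rename-cong e (var x) = cong var (e x)
rename-cong e (M · N) = cong₂ _·_ (rename-cong e M) (rename-cong e N)
rename-cong e (ƛ M)   = cong ƛ_ (rename-cong (ext-cong e) M)

exts-cong : ∀ {σ τ} → (∀ x → σ x ≡ τ x) → ∀ x → exts σ x ≡ exts τ x
exts-cong e zero    = Eq.refl
exts-cong e (suc x) = cong (rename suc) (e x)

sub-cong : ∀ {σ τ} → (∀ x → σ x ≡ τ x) → ∀ M → sub σ M ≡ sub τ M
sub-cong e (var x) = e x
sub-cong e (M · N) = cong₂ _·_ (sub-cong e M) (sub-cong e N)
sub-cong e (ƛ M)   = cong ƛ_ (sub-cong (exts-cong e) M)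

rename-rename : ∀ ρ ρ′ M → rename ρ (rename ρ′ M) ≡ rename (λ x → ρ (ρ′ x)) M
rename-rename ρ ρ′ (var x) = Eq.refl
rename-rename ρ ρ′ (M · N) = cong₂ _·_ (rename-rename ρ ρ′ M) (rename-rename ρ ρ′ N)
rename-rename ρ ρ′ (ƛ M)   = cong ƛ_ (Eq.trans (rename-rename (ext ρ) (ext ρ′) M)
  (rename-cong (λ { zero → Eq.refl ; (suc x) → Eq.refl }) M))

sub-rename : ∀ σ ρ M → sub σ (rename ρ M) ≡ sub (λ x → σ (ρ x)) M
sub-rename σ ρ (var x) = Eq.refl
sub-rename σ ρ (M · N) = cong₂ _·_ (sub-rename σ ρ M) (sub-rename σ ρ N)
sub-rename σ ρ (ƛ M)   = cong ƛ_ (Eq.trans (sub-rename (exts σ) (ext ρ) M)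
  (sub-cong (λ { zero → Eq.refl ; (suc x) → Eq.refl }) M))

rename-sub : ∀ ρ σ M → rename ρ (sub σ M) ≡ sub (λ x → rename ρ (σ x)) M
rename-sub ρ σ (var x) = Eq.refl
rename-sub ρ σ (M · N) = cong₂ _·_ (rename-sub ρ σ M) (rename-sub ρ σ N)
rename-sub ρ σ (ƛ M)   = cong ƛ_ (Eq.trans (rename-sub (ext ρ) (exts σ) M)
  (sub-cong (λ { zero    → Eq.refl
               ; (suc x) → Eq.trans (rename-rename (ext ρ) suc (σ x))
                                    (Eq.sym (rename-rename suc ρ (σ x))) }) M))

sub-sub : ∀ σ τ M → sub σ (sub τ M) ≡ sub (λ x → sub σ (τ x)) M
sub-sub σ τ (var x) = Eq.refl
sub-sub σ τ (M · N) = cong₂ _·_ (sub-sub σ τ M) (sub-sub σ τ N)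
sub-sub σ τ (ƛ M)   = cong ƛ_ (Eq.trans (sub-sub (exts σ) (exts τ) M)
  (sub-cong (λ { zero    → Eq.refl
               ; (suc x) → Eq.trans (sub-rename (exts σ) suc (τ x))
                                    (Eq.sym (rename-sub suc σ (τ x))) }) M))

sub-var : ∀ M → sub var M ≡ M
sub-var (var x) = Eq.refl
sub-var (M · N) = cong₂ _·_ (sub-var M) (sub-var N)
sub-var (ƛ M)   = cong ƛ_ (Eq.trans (sub-cong (λ { zero → Eq.refl ; (suc x) → Eq.refl }) M) (sub-var M))

sub-[] : ∀ σ M N → sub σ (M [ N ]) ≡ (sub (exts σ) M) [ sub σ N ]
sub-[] σ M N = begin
  sub σ (M [ N ])                            ≡⟨ sub-sub σ (σ₀ N) M ⟩
  sub (λ x → sub σ (σ₀ N x)) M               ≡⟨ sub-cong lift-then-contract M ⟩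
  sub (λ x → sub (σ₀ (sub σ N)) (exts σ x)) M ≡⟨ Eq.sym (sub-sub (σ₀ (sub σ N)) (exts σ) M) ⟩
  (sub (exts σ) M) [ sub σ N ]               ∎
  where
  lift-then-contract : ∀ x → sub σ (σ₀ N x) ≡ sub (σ₀ (sub σ N)) (exts σ x)
  lift-then-contract zero    = Eq.refl
  lift-then-contract (suc x) = Eq.sym (Eq.trans (sub-rename (σ₀ (sub σ N)) suc (σ x)) (sub-var (σ x)))

sub-⟶β : ∀ σ {M M′} → M ⟶β M′ → sub σ M ⟶β sub σ M′
sub-⟶β σ (β {M} {N}) = Eq.subst (sub σ ((ƛ M) · N) ⟶β_) (Eq.sym (sub-[] σ M N)) β
sub-⟶β σ (appL s)    = appL (sub-⟶β σ s)
sub-⟶β σ (appR s)    = appR (sub-⟶β σ s)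
sub-⟶β σ (lam s)     = lam (sub-⟶β (exts σ) s)

sub-=β : ∀ σ {M M′} → M =β M′ → sub σ M =β sub σ M′
sub-=β σ (step s)    = step (sub-⟶β σ s)
sub-=β σ refl        = refl
sub-=β σ (sym p)     = sym (sub-=β σ p)
sub-=β σ (trans p q) = trans (sub-=β σ p) (sub-=β σ q)

sub-fixing-free : ∀ σ M → (∀ y → y FreeIn M → σ y ≡ var y) → sub σ M ≡ M
sub-fixing-free σ (var x) h = h x fvar
sub-fixing-free σ (M · N) h =
  cong₂ _·_ (sub-fixing-free σ M (λ y f → h y (fappL f))) (sub-fixing-free σ N (λ y f → h y (fappR f)))
sub-fixing-free σ (ƛ M) h = cong ƛ_ (sub-fixing-free (exts σ) M
  (λ { zero f → Eq.refl ; (suc y) f → cong (rename suc) (h y (flam f)) }))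

appL-=β : ∀ {M M′ N} → M =β M′ → M · N =β M′ · N
appL-=β (step s)    = step (appL s)
appL-=β refl        = refl
appL-=β (sym p)     = sym (appL-=β p)
appL-=β (trans p q) = trans (appL-=β p) (appL-=β q)

apps-=β : ∀ {M M′} Ns → M =β M′ → apps M Ns =β apps M′ Ns
apps-=β List.[]       p = p
apps-=β (N List.∷ Ns) p = apps-=β Ns (appL-=β p)

identity-spine : ∀ m → apps I (toList (replicate m I)) =β I
identity-spine zero    = refl
identity-spine (suc m) = trans (apps-=β (toList (replicate m I)) (step β)) (identity-spine m)

sub-apps-vars : ∀ σ M {m} (v : Vec ℕ m) →
  sub σ (apps M (toList (map var v))) ≡ apps (sub σ M) (toList (map σ v))
sub-apps-vars σ M []      = Eq.refl
sub-apps-vars σ M (x ∷ v) = sub-apps-vars σ (M · var x) v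

free-in-identity-args : ∀ {x} M m → x FreeIn apps M (toList (replicate m I)) → x FreeIn M
free-in-identity-args M zero    f = f
free-in-identity-args M (suc m) f with free-in-identity-args (M · I) m f
... | fappL g         = g
... | fappR (flam ())

Distinct : ∀ {m} → Vec ℕ m → Set
Distinct a = ∀ i j → lookup a i ≡ lookup a j → i ≡ j

distinct-tail : ∀ {m b} {v : Vec ℕ m} → Distinct (b ∷ v) → Distinct v
distinct-tail d i j e = suc-injective (d (Fin.suc i) (Fin.suc j) e)

distinct-head : ∀ {m b} {v : Vec ℕ m} → Distinct (b ∷ v) → ∀ i → ¬ (b ≡ lookup v i)
distinct-head d i e with d Fin.zero (Fin.suc i) e
... | ()

lookup-last : ∀ {k} (a : Vec ℕ (suc k)) → lookup a (fromℕ k) ≡ last a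
lookup-last (x ∷ [])    = Eq.refl
lookup-last (x ∷ y ∷ v) = lookup-last (y ∷ v)

spine : ∀ {k} → Vec ℕ (suc k) → ℕ → Term
spine (_ ∷ [])    y = var y
spine (b ∷ c ∷ v) y with b ≟ y
... | yes _ = I
... | no  _ = spine (c ∷ v) y

spine-outside : ∀ {k} (a : Vec ℕ (suc k)) y → (∀ i → ¬ (lookup a i ≡ y)) → spine a y ≡ var y
spine-outside (_ ∷ [])    y h = Eq.refl
spine-outside (b ∷ c ∷ v) y h with b ≟ y
... | yes e = ⊥-elim (h Fin.zero e)
... | no  _ = spine-outside (c ∷ v) y (λ i → h (Fin.suc i))

spine-first : ∀ {k} b c (v : Vec ℕ k) → spine (b ∷ c ∷ v) b ≡ I
spine-first b c v with b ≟ b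
... | yes _ = Eq.refl
... | no ne = ⊥-elim (ne Eq.refl)

spine-rest : ∀ {k} b c (v : Vec ℕ k) → Distinct (b ∷ c ∷ v) →
  map (spine (b ∷ c ∷ v)) (c ∷ v) ≡ map (spine (c ∷ v)) (c ∷ v)
spine-rest b c v d = agree (c ∷ v) (distinct-head d)
  where
  agree : ∀ {m} (w : Vec ℕ m) → (∀ i → ¬ (b ≡ lookup w i)) →
    map (spine (b ∷ c ∷ v)) w ≡ map (spine (c ∷ v)) w
  agree []      h = Eq.refl
  agree (y ∷ w) h with b ≟ y
  ... | yes e = ⊥-elim (h Fin.zero e)
  ... | no  _ = cong (spine (c ∷ v) y ∷_) (agree w (λ i → h (Fin.suc i)))

spine-args : ∀ {k} (a : Vec ℕ (suc k)) → Distinct a → ∀ P →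
  apps P (toList (map (spine a) a)) ≡ apps P (toList (replicate k I)) · var (last a)
spine-args (x ∷ [])            d P = Eq.refl
spine-args {suc k} (b ∷ c ∷ v) d P = begin
  apps (P · spine (b ∷ c ∷ v) b) (toList (map (spine (b ∷ c ∷ v)) (c ∷ v)))
    ≡⟨ cong₂ (λ Q w → apps (P · Q) (toList w)) (spine-first b c v) (spine-rest b c v d) ⟩
  apps (P · I) (toList (map (spine (c ∷ v)) (c ∷ v)))
    ≡⟨ spine-args (c ∷ v) (distinct-tail d) (P · I) ⟩
  apps (P · I) (toList (replicate k I)) · var (last (c ∷ v))
    ∎

spine-head : ∀ {k} (a : Vec ℕ (suc k)) → Distinct a →
  sub (spine a) (apps (var (head a)) (toList (map var (tail a)))) =β var (last a)
spine-head (x ∷ [])            d = refl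
spine-head {suc k} (b ∷ c ∷ v) d =
  Eq.subst (_=β var (last (c ∷ v))) (Eq.sym collapse)
    (trans (appL-=β (identity-spine k)) (step β))
  where
  collapse : sub (spine (b ∷ c ∷ v)) (apps (var b) (toList (map var (c ∷ v))))
           ≡ apps I (toList (replicate k I)) · var (last (c ∷ v))
  collapse = begin
    sub (spine (b ∷ c ∷ v)) (apps (var b) (toList (map var (c ∷ v))))
      ≡⟨ sub-apps-vars (spine (b ∷ c ∷ v)) (var b) (c ∷ v) ⟩
    apps (spine (b ∷ c ∷ v) b) (toList (map (spine (b ∷ c ∷ v)) (c ∷ v)))
      ≡⟨ cong₂ (λ Q w → apps Q (toList w)) (spine-first b c v) (spine-rest b c v d) ⟩
    apps I (toList (map (spine (c ∷ v)) (c ∷ v)))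
      ≡⟨ spine-args (c ∷ v) (distinct-tail d) I ⟩
    apps I (toList (replicate k I)) · var (last (c ∷ v))
      ∎

spine-instance : ∀ {k} N (a : Vec ℕ (suc k)) → Distinct a → (∀ i → ¬ (lookup a i FreeIn N)) →
  sub (spine a) (apps N (toList (map var a))) ≡ apps N (toList (replicate k I)) · var (last a)
spine-instance {k} N a d fresh = begin
  sub (spine a) (apps N (toList (map var a)))    ≡⟨ sub-apps-vars (spine a) N a ⟩
  apps (sub (spine a) N) (toList (map (spine a) a))
    ≡⟨ cong (λ M → apps M (toList (map (spine a) a))) (sub-fixing-free (spine a) N fixes-free) ⟩
  apps N (toList (map (spine a) a))              ≡⟨ spine-args a d N ⟩
  apps N (toList (replicate k I)) · var (last a) ∎
  where
  fixes-free : ∀ y → y FreeIn N → spine a y ≡ var y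
  fixes-free y f = spine-outside a y (λ i e → fresh i (Eq.subst (_FreeIn N) (Eq.sym e) f))

proposition16 : (k : ℕ) (N : Term) (a : Vec ℕ (suc k))
    → (∀ i j → lookup a i ≡ lookup a j → i ≡ j)
    → (∀ i → ¬ (lookup a i FreeIn N))
    → apps N (toList (map var a))
      =β apps (var (head a)) (toList (map var (tail a))) · apps N (toList (map var a))
    → FixedPointCombinator (apps N (toList (replicate k I)))
proposition16 k N a distinct fresh fixed = last a , last-not-free , fixpoint
  where
  last-not-free : ¬ (last a FreeIn apps N (toList (replicate k I)))
  last-not-free f = fresh (fromℕ k)
    (Eq.subst (_FreeIn N) (Eq.sym (lookup-last a)) (free-in-identity-args N k f))

  fixpoint : apps N (toList (replicate k I)) · var (last a)
          =β var (last a) · (apps N (toList (replicate k I)) · var (last a))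
  fixpoint = Eq.subst (λ Yx → Yx =β var (last a) · Yx) (spine-instance N a distinct fresh)
    (trans (sub-=β (spine a) fixed) (appL-=β (spine-head a distinct)))
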